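{- For each positive integer $d$, the roots in $\mathbb{C}$ of $f_d(z)=z^{d+1}+z-1$ are all distinct. Moreover, $f_d(z)$ and $z(1-z^{d+1})$ have no common roots. -}

module Defs where

open import Level using (Level; _⊔_) renaming (suc to lsuc)
open import Algebra.Bundles using (CommutativeRing)
open import Data.Nat using (ℕ; zero; suc)
open import Data.Fin using (Fin; zero; suc)
open import Data.List using (List; []; _∷_; _∷ʳ_)
open import Data.Product using (∃; _×_)
open import Relation.Nullary using (¬_)
open import Relation.Binary.PropositionalEquality using (_≡_)

module RingOps {c ℓ : Level} (R : CommutativeRing c ℓ) where
  open CommutativeRing R hiding (zero)

  pow : Carrier → ℕ → Carrier
  pow z zero    = 1#
  pow z (suc n) = z * pow z n

  fromℕ : ℕ → Carrier
  fromℕ zero    = 0#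
  fromℕ (suc n) = 1# + fromℕ n

  eval : List Carrier → Carrier → Carrier
  eval []       z = 0#
  eval (a ∷ as) z = a + z * eval as z

  prodFin : (n : ℕ) → (Fin n → Carrier) → Carrier
  prodFin zero    f = 1#
  prodFin (suc n) f = f zero * prodFin n (λ i → f (suc i))

-- An algebraically closed field of characteristic zero (stand-in for ℂ).
record AlgClosedFieldChar0 (c ℓ : Level) : Set (lsuc (c ⊔ ℓ)) where
  field
    cring : CommutativeRing c ℓ
  open CommutativeRing cring public hiding (zero)
  open RingOps cring public
  field
    1≉0       : ¬ (1# ≈ 0#)
    inverse   : ∀ x → ¬ (x ≈ 0#) → ∃ λ y → x * y ≈ 1#
    char0     : ∀ n → ¬ (fromℕ (suc n) ≈ 0#)
    -- every monic polynomial of degree ≥ 1, c₀ + c₁ z + … + cₖ zᵏ + z^(k+1), has a root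
    algClosed : ∀ (a : Carrier) (as : List Carrier) → ∃ λ z → eval ((a ∷ as) ∷ʳ 1#) z ≈ 0#

  f : ℕ → Carrier → Carrier
  f d z = pow z (suc d) + z + (- 1#)

  g : ℕ → Carrier → Carrier
  g d z = z * (1# + (- pow z (suc d)))

-- Over an algebraically closed field a monic polynomial p having no root in common with its
-- formal derivative splits into distinct linear factors: split off a root ρ by synthetic
-- division, p = (z - ρ) q; then q(ρ) = p′(ρ) ≠ 0, so ρ is not a root of q, and q inherits the
-- hypothesis. For p = f_d, a common root of f_d and f_d′ satisfies d z = d + 1 (combine
-- z^(d+1) + z = 1 with (d+1) z^(d+1) + z = 0), and substituting back shows that the positive
-- integer (d+1)^(d+2) + d^d (d+1) vanishes in the field, which characteristic zero forbids.
-- Finally f_d(0) = -1, so a root z of f_d is nonzero; g_d(z) = 0 then forces z^(d+1) = 1, and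
-- f_d(z) = 0 becomes z = 0.
module Submission where

open import Defs
open import Level using (Level; _⊔_)
open import Data.Nat using (ℕ; suc; _≤_)
open import Data.Fin using (Fin; zero; suc)
open import Data.Product using (∃; _×_; _,_; map₂)
open import Relation.Nullary using (¬_)
open import Relation.Binary.PropositionalEquality using (_≡_)

open import Algebra.Bundles using (CommutativeRing)
import Algebra.Properties.Ring as RingProperties
import Algebra.Solver.Ring.NaturalCoefficients.Default as NaturalCoefficientsSolver
import Data.Nat as ℕ
import Data.Nat.Properties as ℕ
open import Data.Vec using (Vec; []; _∷_; replicate; toList)
open import Data.Vec.Functional renaming (_∷_ to _◃_) using ()
open import Data.List using (_∷ʳ_)
open import Data.Empty using (⊥-elim)
open import Function using (_∘_)
import Relation.Binary.PropositionalEquality as ≡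
import Relation.Binary.Reasoning.Setoid as SetoidReasoning

module MonicPolynomial {c ℓ : Level} (R : CommutativeRing c ℓ) where
  open CommutativeRing R hiding (zero)
  open RingOps R
  open RingProperties ring using (+-cancelʳ; //-rightDividesˡ; [y-z]x≈yx-zx)
  open NaturalCoefficientsSolver commutativeSemiring using (solve; _:+_; _:*_; _:=_; con)
  open SetoidReasoning setoid

  -- cs = c₀ ∷ … ∷ cₙ₋₁ stands for the monic polynomial c₀ + c₁ z + … + cₙ₋₁ zⁿ⁻¹ + zⁿ.
  evalMonic : ∀ {n} → Vec Carrier n → Carrier → Carrier
  evalMonic []       z = 1#
  evalMonic (a ∷ cs) z = a + z * evalMonic cs z

  derivative : ∀ {n} → Vec Carrier n → Carrier → Carrier
  derivative []       z = 0#
  derivative (a ∷ cs) z = evalMonic cs z + z * derivative cs z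

  quotient : ∀ {n} → Carrier → Vec Carrier (suc n) → Vec Carrier n
  quotient {ℕ.zero} r (a ∷ []) = []
  quotient {suc n}  r (a ∷ cs) = evalMonic cs r ∷ quotient r cs

  evalMonic-cong : ∀ {n} (cs : Vec Carrier n) {x y} → x ≈ y → evalMonic cs x ≈ evalMonic cs y
  evalMonic-cong []       x≈y = refl
  evalMonic-cong (a ∷ cs) x≈y = +-congˡ (*-cong x≈y (evalMonic-cong cs x≈y))

  eval≈evalMonic : ∀ {n} (cs : Vec Carrier n) z → eval (toList cs ∷ʳ 1#) z ≈ evalMonic cs z
  eval≈evalMonic []       z = trans (+-congˡ (zeroʳ z)) (+-identityʳ 1#)
  eval≈evalMonic (a ∷ cs) z = +-congˡ (*-congˡ (eval≈evalMonic cs z))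

  -- Division by z - r, with the subtraction moved to the other side so that it is a semiring identity.
  quotient-evalMonic : ∀ {n} r (cs : Vec Carrier (suc n)) z →
    evalMonic cs z + r * evalMonic (quotient r cs) z ≈ evalMonic cs r + z * evalMonic (quotient r cs) z
  quotient-evalMonic {ℕ.zero} r (a ∷ []) z =
    solve 3 (λ a z r → (a :+ z :* con 1) :+ r :* con 1 := (a :+ r :* con 1) :+ z :* con 1) refl a z r
  quotient-evalMonic {suc n} r (a ∷ cs) z = begin
    (a + z * p z) + r * (p r + z * q z)   ≈⟨ solve 6 (λ a z r pz pr qz →
                                               (a :+ z :* pz) :+ r :* (pr :+ z :* qz)
                                            := (a :+ r :* pr) :+ z :* (pz :+ r :* qz)) refl a z r (p z) (p r) (q z) ⟩
    (a + r * p r) + z * (p z + r * q z)   ≈⟨ +-congˡ (*-congˡ (quotient-evalMonic r cs z)) ⟩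
    (a + r * p r) + z * (p r + z * q z)   ∎
    where
    p q : Carrier → Carrier
    p = evalMonic cs
    q = evalMonic (quotient r cs)

  quotient-derivative : ∀ {n} r (cs : Vec Carrier (suc n)) z →
    derivative cs z + r * derivative (quotient r cs) z ≈ evalMonic (quotient r cs) z + z * derivative (quotient r cs) z
  quotient-derivative {ℕ.zero} r (a ∷ []) z =
    solve 2 (λ z r → (con 1 :+ z :* con 0) :+ r :* con 0 := con 1 :+ z :* con 0) refl z r
  quotient-derivative {suc n} r (a ∷ cs) z = begin
    (p z + z * p′) + r * (q z + z * q′)  ≈⟨ solve 6 (λ z r pz p′ qz q′ →
                                              (pz :+ z :* p′) :+ r :* (qz :+ z :* q′)
                                           := (pz :+ r :* qz) :+ z :* (p′ :+ r :* q′)) refl z r (p z) p′ (q z) q′ ⟩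
    (p z + r * q z) + z * (p′ + r * q′)  ≈⟨ +-cong (quotient-evalMonic r cs z) (*-congˡ (quotient-derivative r cs z)) ⟩
    (p r + z * q z) + z * (q z + z * q′) ∎
    where
    p q : Carrier → Carrier
    p = evalMonic cs
    q = evalMonic (quotient r cs)
    p′ q′ : Carrier
    p′ = derivative cs z
    q′ = derivative (quotient r cs) z

  +-*-transpose : ∀ {x y s r z} → x + r * y ≈ s + z * y → x ≈ s + (z - r) * y
  +-*-transpose {x} {y} {s} {r} {z} eq = +-cancelʳ (r * y) x (s + (z - r) * y) (begin
    x + r * y                   ≈⟨ eq ⟩
    s + z * y                   ≈⟨ +-congˡ (//-rightDividesˡ (r * y) (z * y)) ⟨
    s + (z * y - r * y + r * y) ≈⟨ +-congˡ (+-congʳ ([y-z]x≈yx-zx y z r)) ⟨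
    s + ((z - r) * y + r * y)   ≈⟨ +-assoc s _ _ ⟨
    s + (z - r) * y + r * y     ∎)

  evalMonic-divide : ∀ {n} r (cs : Vec Carrier (suc n)) z →
    evalMonic cs z ≈ evalMonic cs r + (z - r) * evalMonic (quotient r cs) z
  evalMonic-divide r cs z = +-*-transpose (quotient-evalMonic r cs z)

  derivative-divide : ∀ {n} r (cs : Vec Carrier (suc n)) z →
    derivative cs z ≈ evalMonic (quotient r cs) z + (z - r) * derivative (quotient r cs) z
  derivative-divide r cs z = +-*-transpose (quotient-derivative r cs z)

  evalMonic-monomial : ∀ n z → evalMonic (replicate n 0#) z ≈ pow z n
  evalMonic-monomial ℕ.zero  z = refl
  evalMonic-monomial (suc n) z = trans (+-identityˡ _) (*-congˡ (evalMonic-monomial n z))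

  derivative-monomial : ∀ n z → z * derivative (replicate n 0#) z ≈ fromℕ n * pow z n
  derivative-monomial ℕ.zero  z = trans (zeroʳ z) (sym (zeroˡ 1#))
  derivative-monomial (suc n) z = begin
    z * (evalMonic (replicate n 0#) z + z * derivative (replicate n 0#) z)
      ≈⟨ *-congˡ (+-cong (evalMonic-monomial n z) (derivative-monomial n z)) ⟩
    z * (pow z n + fromℕ n * pow z n)
      ≈⟨ solve 3 (λ z zⁿ n → z :* (zⁿ :+ n :* zⁿ) := (con 1 :+ n) :* (z :* zⁿ)) refl z (pow z n) (fromℕ n) ⟩
    (1# + fromℕ n) * (z * pow z n) ∎

  prodFin-zero : ∀ n (h : Fin n → Carrier) j → h j ≈ 0# → prodFin n h ≈ 0#
  prodFin-zero (suc n) h zero    hj≈0 = trans (*-congʳ hj≈0) (zeroˡ _)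
  prodFin-zero (suc n) h (suc j) hj≈0 = trans (*-congˡ (prodFin-zero n (h ∘ suc) j hj≈0)) (zeroʳ _)

module Trinomial {c ℓ : Level} (R : CommutativeRing c ℓ) where
  open CommutativeRing R hiding (zero)
  open RingOps R
  open NaturalCoefficientsSolver commutativeSemiring using (solve; _:+_; _:*_; _:=_; con)
  open SetoidReasoning setoid

  fromℕ-+ : ∀ m n → fromℕ (m ℕ.+ n) ≈ fromℕ m + fromℕ n
  fromℕ-+ ℕ.zero  n = sym (+-identityˡ _)
  fromℕ-+ (suc m) n = trans (+-congˡ (fromℕ-+ m n)) (sym (+-assoc 1# _ _))

  fromℕ-* : ∀ m n → fromℕ (m ℕ.* n) ≈ fromℕ m * fromℕ n
  fromℕ-* ℕ.zero  n = sym (zeroˡ _)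
  fromℕ-* (suc m) n = begin
    fromℕ (n ℕ.+ m ℕ.* n)        ≈⟨ fromℕ-+ n (m ℕ.* n) ⟩
    fromℕ n + fromℕ (m ℕ.* n)    ≈⟨ +-congˡ (fromℕ-* m n) ⟩
    fromℕ n + fromℕ m * fromℕ n  ≈⟨ solve 2 (λ m n → n :+ m :* n := (con 1 :+ m) :* n) refl (fromℕ m) (fromℕ n) ⟩
    (1# + fromℕ m) * fromℕ n     ∎

  fromℕ-^ : ∀ m k → fromℕ (m ℕ.^ k) ≈ pow (fromℕ m) k
  fromℕ-^ m ℕ.zero  = +-identityʳ 1#
  fromℕ-^ m (suc k) = trans (fromℕ-* m (m ℕ.^ k)) (*-congˡ (fromℕ-^ m k))

  pow-cong : ∀ k {x y} → x ≈ y → pow x k ≈ pow y k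
  pow-cong ℕ.zero  x≈y = refl
  pow-cong (suc k) x≈y = *-cong x≈y (pow-cong k x≈y)

  pow-distrib-* : ∀ x y k → pow (x * y) k ≈ pow x k * pow y k
  pow-distrib-* x y ℕ.zero  = sym (*-identityˡ 1#)
  pow-distrib-* x y (suc k) = trans (*-congˡ (pow-distrib-* x y k))
    (solve 4 (λ x y xᵏ yᵏ → (x :* y) :* (xᵏ :* yᵏ) := (x :* xᵏ) :* (y :* yᵏ)) refl x y (pow x k) (pow y k))

  trinomial-discriminant : ∀ d z → pow z (suc d) + z ≈ 1# → fromℕ (suc d) * pow z (suc d) + z ≈ 0# →
    fromℕ (suc d ℕ.^ suc (suc d) ℕ.+ d ℕ.^ d ℕ.* suc d) ≈ 0#
  trinomial-discriminant d z w+z≈1 Nw+z≈0 = begin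
    fromℕ (suc d ℕ.^ suc (suc d) ℕ.+ d ℕ.^ d ℕ.* suc d)
      ≈⟨ fromℕ-+ (suc d ℕ.^ suc (suc d)) (d ℕ.^ d ℕ.* suc d) ⟩
    fromℕ (suc d ℕ.^ suc (suc d)) + fromℕ (d ℕ.^ d ℕ.* suc d)
      ≈⟨ +-cong (fromℕ-^ (suc d) (suc (suc d))) (trans (fromℕ-* (d ℕ.^ d) (suc d)) (*-congʳ (fromℕ-^ d d))) ⟩
    N * pow N (suc d) + pow D d * N   ≈⟨ +-cong (*-congˡ (pow-cong (suc d) Dz≈N)) (*-congˡ Dz≈N) ⟨
    N * pow (D * z) (suc d) + pow D d * (D * z)
      ≈⟨ +-congʳ (*-congˡ (pow-distrib-* D z (suc d))) ⟩
    N * (pow D (suc d) * w) + pow D d * (D * z)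
      ≈⟨ solve 5 (λ Dᵈ D N w z → N :* ((D :* Dᵈ) :* w) :+ Dᵈ :* (D :* z) := (D :* Dᵈ) :* (N :* w :+ z))
           refl (pow D d) D N w z ⟩
    pow D (suc d) * (N * w + z)      ≈⟨ *-congˡ Nw+z≈0 ⟩
    pow D (suc d) * 0#               ≈⟨ zeroʳ _ ⟩
    0#                               ∎
    where
    D N w : Carrier
    D = fromℕ d
    N = fromℕ (suc d)
    w = pow z (suc d)
    Dz≈N : D * z ≈ N
    Dz≈N = begin
      D * z                ≈⟨ +-identityʳ _ ⟨
      D * z + 0#           ≈⟨ +-congˡ Nw+z≈0 ⟨
      D * z + (N * w + z)  ≈⟨ solve 3 (λ D w z → D :* z :+ ((con 1 :+ D) :* w :+ z) := (con 1 :+ D) :* (w :+ z)) refl D w z ⟩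
      N * (w + z)          ≈⟨ *-congˡ w+z≈1 ⟩
      N * 1#               ≈⟨ *-identityʳ N ⟩
      N                    ∎

module AlgebraicallyClosedField {c ℓ : Level} (K : AlgClosedFieldChar0 c ℓ) where
  open AlgClosedFieldChar0 K
  open MonicPolynomial cring
  open Trinomial cring using (trinomial-discriminant)
  open RingProperties ring using (x∙y⁻¹≈ε⇒x≈y; +-cancelˡ)
  open NaturalCoefficientsSolver commutativeSemiring using (solve; _:+_; _:*_; _:=_; con)
  open SetoidReasoning setoid

  *-cancelˡ-≉0 : ∀ {x y} → ¬ x ≈ 0# → x * y ≈ 0# → y ≈ 0#
  *-cancelˡ-≉0 {x} {y} x≉0 xy≈0 with inverse x x≉0
  ... | x⁻¹ , xx⁻¹≈1 = begin
    y               ≈⟨ *-identityˡ y ⟨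
    1# * y          ≈⟨ *-congʳ xx⁻¹≈1 ⟨
    (x * x⁻¹) * y   ≈⟨ solve 3 (λ x x⁻¹ y → (x :* x⁻¹) :* y := x⁻¹ :* (x :* y)) refl x x⁻¹ y ⟩
    x⁻¹ * (x * y)   ≈⟨ *-congˡ xy≈0 ⟩
    x⁻¹ * 0#        ≈⟨ zeroʳ x⁻¹ ⟩
    0#              ∎

  fromℕ≉0 : ∀ {n} → 0 ℕ.< n → ¬ fromℕ n ≈ 0#
  fromℕ≉0 {suc n} _ = char0 n

  monic-root : ∀ {n} (cs : Vec Carrier (suc n)) → ∃ λ z → evalMonic cs z ≈ 0#
  monic-root (a ∷ cs) with algClosed a (toList cs)
  ... | z , root = z , trans (sym (eval≈evalMonic (a ∷ cs) z)) root

  Separable : ∀ {n} → Vec Carrier n → Set (c ⊔ ℓ)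
  Separable cs = ∀ z → evalMonic cs z ≈ 0# → ¬ derivative cs z ≈ 0#

  separable-quotient : ∀ {n} (cs : Vec Carrier (suc n)) {ρ} → Separable cs → evalMonic cs ρ ≈ 0# →
    Separable (quotient ρ cs)
  separable-quotient cs {ρ} sep ρ-root w q≈0 q′≈0 = sep w
    (trans (evalMonic-divide ρ cs w) (vanishes ρ-root q≈0))
    (trans (derivative-divide ρ cs w) (vanishes q≈0 q′≈0))
    where
    vanishes : ∀ {x y u} → x ≈ 0# → y ≈ 0# → x + u * y ≈ 0#
    vanishes x≈0 y≈0 = trans (+-cong x≈0 (trans (*-congˡ y≈0) (zeroʳ _))) (+-identityʳ 0#)

  -- At a root ρ the quotient takes the value of the derivative.
  quotient-nonvanishing : ∀ {n} (cs : Vec Carrier (suc n)) {ρ} → Separable cs → evalMonic cs ρ ≈ 0# →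
    ¬ evalMonic (quotient ρ cs) ρ ≈ 0#
  quotient-nonvanishing cs {ρ} sep ρ-root q≈0 = sep ρ ρ-root (begin
    derivative cs ρ                                            ≈⟨ derivative-divide ρ cs ρ ⟩
    evalMonic (quotient ρ cs) ρ + (ρ - ρ) * derivative (quotient ρ cs) ρ
      ≈⟨ +-cong q≈0 (trans (*-congʳ (-‿inverseʳ ρ)) (zeroˡ _)) ⟩
    0# + 0#                                                    ≈⟨ +-identityʳ 0# ⟩
    0#                                                         ∎)

  ◃-injective : ∀ {n ρ} {r : Fin n → Carrier} → (∀ j → ¬ ρ ≈ r j) → (∀ i j → r i ≈ r j → i ≡ j) →
    ∀ i j → (ρ ◃ r) i ≈ (ρ ◃ r) j → i ≡ j
  ◃-injective ρ∉r r-injective zero    zero    _  = ≡.refl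
  ◃-injective ρ∉r r-injective zero    (suc j) eq = ⊥-elim (ρ∉r j eq)
  ◃-injective ρ∉r r-injective (suc i) zero    eq = ⊥-elim (ρ∉r i (sym eq))
  ◃-injective ρ∉r r-injective (suc i) (suc j) eq = ≡.cong suc (r-injective i j eq)

  separable-splits : ∀ {n} (cs : Vec Carrier n) → Separable cs →
    ∃ λ (r : Fin n → Carrier) → (∀ i j → r i ≈ r j → i ≡ j) × (∀ z → evalMonic cs z ≈ prodFin n (λ i → z - r i))
  separable-splits []           _   = (λ ()) , (λ ()) , λ _ → refl
  separable-splits cs@(_ ∷ _) sep with monic-root cs
  ... | ρ , ρ-root with separable-splits (quotient ρ cs) (separable-quotient cs sep ρ-root)
  ... | r , r-injective , q≈∏ = ρ ◃ r , ◃-injective ρ∉r r-injective , factorisation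
    where
    ρ∉r : ∀ j → ¬ ρ ≈ r j
    ρ∉r j ρ≈rj = quotient-nonvanishing cs sep ρ-root (begin
      evalMonic (quotient ρ cs) ρ      ≈⟨ evalMonic-cong (quotient ρ cs) ρ≈rj ⟩
      evalMonic (quotient ρ cs) (r j)  ≈⟨ q≈∏ (r j) ⟩
      prodFin _ (λ i → r j - r i)      ≈⟨ prodFin-zero _ _ j (-‿inverseʳ (r j)) ⟩
      0#                               ∎)
    factorisation : ∀ z → evalMonic cs z ≈ prodFin _ (λ i → z - (ρ ◃ r) i)
    factorisation z = begin
      evalMonic cs z                                          ≈⟨ evalMonic-divide ρ cs z ⟩
      evalMonic cs ρ + (z - ρ) * evalMonic (quotient ρ cs) z  ≈⟨ +-cong ρ-root (*-congˡ (q≈∏ z)) ⟩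
      0# + (z - ρ) * prodFin _ (λ i → z - r i)                ≈⟨ +-identityˡ _ ⟩
      (z - ρ) * prodFin _ (λ i → z - r i)                     ∎

  fMonic : ∀ e → Vec Carrier (suc (suc e))
  fMonic e = - 1# ∷ 1# ∷ replicate e 0#

  evalMonic-fMonic : ∀ e z → evalMonic (fMonic e) z ≈ f (suc e) z
  evalMonic-fMonic e z = begin
    - 1# + z * (1# + z * evalMonic (replicate e 0#) z)
      ≈⟨ +-congˡ (*-congˡ (+-congˡ (*-congˡ (evalMonic-monomial e z)))) ⟩
    - 1# + z * (1# + z * pow z e)
      ≈⟨ solve 3 (λ m z zᵉ → m :+ z :* (con 1 :+ z :* zᵉ) := (z :* (z :* zᵉ) :+ z) :+ m) refl (- 1#) z (pow z e) ⟩
    z * (z * pow z e) + z + - 1#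
      ∎

  -- The derivative of 1 ∷ cs does not depend on the constant term, so it is that of the monomial.
  derivative-fMonic : ∀ e z → z * derivative (fMonic e) z ≈ fromℕ (suc (suc e)) * pow z (suc (suc e)) + z
  derivative-fMonic e z = begin
    z * ((1# + z * evalMonic (replicate e 0#) z) + z * derivative (replicate (suc e) 0#) z)
      ≈⟨ *-congˡ (+-cong (+-congˡ (*-congˡ (evalMonic-monomial e z))) (derivative-monomial (suc e) z)) ⟩
    z * ((1# + z * pow z e) + fromℕ (suc e) * (z * pow z e))
      ≈⟨ solve 3 (λ z zᵉ E → z :* ((con 1 :+ z :* zᵉ) :+ (con 1 :+ E) :* (z :* zᵉ))
                           := (con 1 :+ (con 1 :+ E)) :* (z :* (z :* zᵉ)) :+ z) refl z (pow z e) (fromℕ e) ⟩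
    fromℕ (suc (suc e)) * pow z (suc (suc e)) + z
      ∎

  f-root : ∀ d z → f d z ≈ 0# → pow z (suc d) + z ≈ 1#
  f-root d z = x∙y⁻¹≈ε⇒x≈y (pow z (suc d) + z) 1#

  fMonic-separable : ∀ e → Separable (fMonic e)
  fMonic-separable e z f≈0 f′≈0 = fromℕ≉0 discriminant>0 (trinomial-discriminant (suc e) z w+z≈1 Nw+z≈0)
    where
    w+z≈1 : pow z (suc (suc e)) + z ≈ 1#
    w+z≈1 = f-root (suc e) z (trans (sym (evalMonic-fMonic e z)) f≈0)
    Nw+z≈0 : fromℕ (suc (suc e)) * pow z (suc (suc e)) + z ≈ 0#
    Nw+z≈0 = trans (sym (derivative-fMonic e z)) (trans (*-congˡ f′≈0) (zeroʳ z))
    discriminant>0 : 0 ℕ.< suc (suc e) ℕ.^ suc (suc (suc e)) ℕ.+ suc e ℕ.^ suc e ℕ.* suc (suc e)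
    discriminant>0 = ℕ.≤-trans (ℕ.m^n>0 (suc (suc e)) (suc (suc (suc e)))) (ℕ.m≤m+n _ _)

  f-splits-distinct : ∀ e → ∃ λ (r : Fin (suc (suc e)) → Carrier) →
    (∀ i j → r i ≈ r j → i ≡ j) × (∀ z → f (suc e) z ≈ prodFin (suc (suc e)) (λ i → z - r i))
  f-splits-distinct e = map₂ (map₂ (λ fMonic≈∏ z → trans (sym (evalMonic-fMonic e z)) (fMonic≈∏ z)))
    (separable-splits (fMonic e) (fMonic-separable e))

  f-g-coprime : ∀ d z → f d z ≈ 0# → ¬ g d z ≈ 0#
  f-g-coprime d z f≈0 g≈0 = z≉0 (+-cancelˡ 1# z 0# (begin
    1# + z  ≈⟨ +-congʳ w≈1 ⟨
    w + z   ≈⟨ w+z≈1 ⟩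
    1#      ≈⟨ +-identityʳ 1# ⟨
    1# + 0# ∎))
    where
    w : Carrier
    w = pow z (suc d)
    w+z≈1 : w + z ≈ 1#
    w+z≈1 = f-root d z f≈0
    z≉0 : ¬ z ≈ 0#
    z≉0 z≈0 = 1≉0 (begin
      1#       ≈⟨ w+z≈1 ⟨
      w + z    ≈⟨ +-cong (trans (*-congʳ z≈0) (zeroˡ _)) z≈0 ⟩
      0# + 0#  ≈⟨ +-identityʳ 0# ⟩
      0#       ∎)
    w≈1 : w ≈ 1#
    w≈1 = sym (x∙y⁻¹≈ε⇒x≈y 1# w (*-cancelˡ-≉0 z≉0 g≈0))

lemmaA1 : ∀ {c ℓ : Level} (K : AlgClosedFieldChar0 c ℓ) (d : ℕ) → 1 ≤ d →
    let open AlgClosedFieldChar0 K in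
    (∃ λ (r : Fin (suc d) → Carrier) →
        (∀ i j → r i ≈ r j → i ≡ j)
      × (∀ z → f d z ≈ prodFin (suc d) (λ i → z + (- r i))))
    × (∀ z → f d z ≈ 0# → ¬ (g d z ≈ 0#))
lemmaA1 K (suc e) _ = f-splits-distinct e , f-g-coprime (suc e)
  where open AlgebraicallyClosedField K
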